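{- Let $(L,\le)$ be a finite partial lattice and let $k$ be a positive integer. Form a block decomposition of $L$ with block size $k$ as follows: set $L_0 = L$; while the current poset $L_{\mathrm{cur}}$ contains an element $h$ with $|\{z \in L_{\mathrm{cur}} : z \le h\}| \ge k$ such that every other element $x$ of $\{z \in L_{\mathrm{cur}} : z \le h\}$ satisfies $|\{z \in L_{\mathrm{cur}} : z \le x\}| < k$, choose such an $h$, create the block $B = \{z \in L_{\mathrm{cur}} : z \le h\}$, and delete $B$ from $L_{\mathrm{cur}}$; when no such $h$ exists, the remaining elements form one further block (the residual block). Then every block of this decomposition, with the order inherited from $L$, is a partial lattice.
   Context: A partial lattice is a partially ordered set $(P,\le)$ satisfying the lattice property: whenever $x_1,x_2,y_1,y_2 \in P$ satisfy $x_1,x_2 < y_1,y_2$ (i.e. $x_a<y_b$ for all $a,b\in\{1,2\}$), there is $z \in P$ with $x_1,x_2 \le z \le y_1,y_2$. Equivalently, any two elements with a common lower bound have a unique greatest common lower bound (meet) and any two elements with a common upper bound have a unique least common upper bound (join); a partial lattice need not have a top or bottom element. -}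

module Defs where

open import Level using (0ℓ)
open import Data.Nat using (ℕ; _<_; _≥_)
open import Data.Fin using (Fin)
open import Data.Fin.Subset using (Subset; _∈_; _─_; ∣_∣; inside; outside)
open import Data.Bool using (Bool; true; false; _∧_; if_then_else_)
open import Data.Vec using (tabulate; lookup)
open import Data.List using (List; []; _∷_)
open import Data.Product using (Σ; _×_; _,_)
open import Relation.Binary using (Rel; Decidable)
open import Relation.Binary.PropositionalEquality using (_≡_)
open import Relation.Nullary using (¬_; Dec; yes; no)

-- A finite poset is represented with carrier Fin n, a (decidable) order
-- relation _≤_ on it (hypothesis IsPartialOrder _≡_ _≤_ is imposed in the statement).
module Order {n : ℕ} (_≤_ : Rel (Fin n) 0ℓ) (_≤?_ : Decidable _≤_) where

  _<ₒ_ : Rel (Fin n) 0ℓ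
  x <ₒ y = (x ≤ y) × ¬ (x ≡ y)

  IsPartialLatticeOn : Subset n → Set
  IsPartialLatticeOn S =
    ∀ x₁ x₂ y₁ y₂ → x₁ ∈ S → x₂ ∈ S → y₁ ∈ S → y₂ ∈ S →
    x₁ <ₒ y₁ → x₁ <ₒ y₂ → x₂ <ₒ y₁ → x₂ <ₒ y₂ →
    Σ (Fin n) λ z → z ∈ S × x₁ ≤ z × x₂ ≤ z × z ≤ y₁ × z ≤ y₂

  down : Subset n → Fin n → Subset n
  down S h = tabulate λ z → lookup S z ∧ (decide (z ≤? h))
    where
      decide : ∀ {A : Set} → Dec A → Bool
      decide (yes _) = true
      decide (no _)  = false

  Admissible : ℕ → Subset n → Fin n → Set
  Admissible k S h =
    h ∈ S × ∣ down S h ∣ ≥ k ×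
    (∀ x → x ∈ down S h → ¬ (x ≡ h) → ∣ down S x ∣ < k)

  -- BlockDecomp k S bs : bs is a list of blocks that the greedy procedure,
  -- started on the current poset S, can produce (for some sequence of choices).
  data BlockDecomp (k : ℕ) : Subset n → List (Subset n) → Set where
    residual : ∀ {S} → ¬ (Σ (Fin n) λ h → Admissible k S h) →
               BlockDecomp k S (S ∷ [])
    step     : ∀ {S bs} (h : Fin n) → Admissible k S h →
               BlockDecomp k (S ─ down S h) bs →
               BlockDecomp k S (down S h ∷ bs)

module Submission where

-- Call S ⊆ L convex if a, b ∈ S and a ≤ c ≤ b imply c ∈ S.  A convex
-- subset of a partial lattice is again a partial lattice: the element z
-- that the lattice property of L squeezes between x₁,x₂ and y₁,y₂ lies
-- between two members of S.  So it suffices to show that every block is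
-- convex, which follows from the invariant that the current poset is
-- up-closed in L:
--   * L itself is up-closed;
--   * removing a block {z ∈ S : z ≤ h} from an up-closed S leaves an
--     up-closed set;
--   * such a block, cut from an up-closed S, is convex, and the residual
--     block is convex because it is up-closed.

open import Defs
open import Level using (0ℓ)
open import Data.Nat using (ℕ; _≤_)
open import Data.Fin using (Fin; zero; suc)
open import Data.Fin.Subset using (Subset; ⊤; _∈_; _∉_; _⊆_; _─_; inside; outside)
open import Data.Fin.Subset.Properties using (∈⊤; ⊆⊤; _∈?_; x∈p∧x∉q⇒x∈p─q; p─q⊆p)
open import Data.List using (List; _∷_)
open import Data.List.Relation.Unary.All as All using (All; []; _∷_)
open import Data.Bool using (true; false; _∧_)
open import Data.Vec using (_∷_; lookup; there)
open import Data.Vec.Properties using (lookup∘tabulate; []=⇒lookup; lookup⇒[]=)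
open import Data.Product using (_×_; _,_; proj₂)
open import Function using (_∋_)
open import Relation.Binary using (Rel; Decidable; Transitive; IsPartialOrder)
open import Relation.Binary.PropositionalEquality using (_≡_; refl; trans; sym; cong₂)
open import Relation.Nullary using (yes; no; does; contradiction)
open import Relation.Nullary.Decidable using (dec-true)

x∈p─q⇒x∉q : ∀ {n} {x : Fin n} {p q : Subset n} → x ∈ p ─ q → x ∉ q
x∈p─q⇒x∉q {x = zero}  {_ ∷ _} {inside  ∷ _} ()
x∈p─q⇒x∉q {x = zero}  {_ ∷ _} {outside ∷ _} _         ()
x∈p─q⇒x∉q {x = suc _} {_ ∷ _} {_ ∷ _}       (there m) (there m′) = x∈p─q⇒x∉q m m′

module _ {n : ℕ} (_≼_ : Rel (Fin n) 0ℓ) (_≼?_ : Decidable _≼_) where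
  open Order _≼_ _≼?_

  lookup-down : ∀ S h z → lookup (down S h) z ≡ lookup S z ∧ does (z ≼? h)
  lookup-down S h z rewrite (lookup (down S h) z ≡ _ ∋ lookup∘tabulate _ z)
    with z ≼? h
  ... | yes _ = refl
  ... | no  _ = refl

  ∈-down⁻ : ∀ {S h z} → z ∈ down S h → z ∈ S × z ≼ h
  ∈-down⁻ {S} {h} {z} z∈down
    with lookup S z in z∈S | z ≼? h | trans (sym (lookup-down S h z)) ([]=⇒lookup z∈down)
  ... | true  | yes z≼h | _  = lookup⇒[]= z S z∈S , z≼h
  ... | true  | no  _   | ()
  ... | false | _       | ()

  ∈-down⁺ : ∀ {S h z} → z ∈ S → z ≼ h → z ∈ down S h
  ∈-down⁺ {S} {h} {z} z∈S z≼h = lookup⇒[]= z (down S h) (trans (lookup-down S h z)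
    (cong₂ _∧_ ([]=⇒lookup z∈S) (dec-true (z ≼? h) z≼h)))

  UpClosed : Subset n → Set
  UpClosed S = ∀ {a c} → a ∈ S → a ≼ c → c ∈ S

  Convex : Subset n → Set
  Convex S = ∀ {a b c} → a ∈ S → b ∈ S → a ≼ c → c ≼ b → c ∈ S

  upClosed⇒convex : ∀ {S} → UpClosed S → Convex S
  upClosed⇒convex S↑ a∈S _ a≼c _ = S↑ a∈S a≼c

  module _ (≼-trans : Transitive _≼_) where

    down-convex : ∀ {S h} → UpClosed S → Convex (down S h)
    down-convex {S} {h} S↑ a∈D b∈D a≼c c≼b
      with ∈-down⁻ {S} {h} a∈D | ∈-down⁻ {S} {h} b∈D
    ... | a∈S , _ | _ , b≼h = ∈-down⁺ (S↑ a∈S a≼c) (≼-trans c≼b b≼h)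

    -- Deleting a block from an up-closed set leaves an up-closed set:
    -- anything above a survivor that lay in the block would drag the
    -- survivor into the block as well.
    ─down-upClosed : ∀ {S h} → UpClosed S → UpClosed (S ─ down S h)
    ─down-upClosed {S} {h} S↑ {a} {c} a∈R a≼c with c ∈? down S h
    ... | yes c∈D = contradiction
            (∈-down⁺ a∈S (≼-trans a≼c (proj₂ (∈-down⁻ {S} {h} c∈D))))
            (x∈p─q⇒x∉q a∈R)
      where a∈S = p─q⊆p S (down S h) a∈R
    ... | no  c∉D = x∈p∧x∉q⇒x∈p─q (S↑ (p─q⊆p S (down S h) a∈R) a≼c) c∉D

    blocks-convex : ∀ {k S bs} → UpClosed S → BlockDecomp k S bs → All Convex bs
    blocks-convex S↑ (residual _) = upClosed⇒convex S↑ ∷ []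
    blocks-convex S↑ (step h _ d) = down-convex S↑ ∷ blocks-convex (─down-upClosed S↑) d

  convex⇒partialLattice : ∀ {S T} → S ⊆ T → IsPartialLatticeOn T →
                          Convex S → IsPartialLatticeOn S
  convex⇒partialLattice S⊆T T-lattice S-convex
    x₁ x₂ y₁ y₂ x₁∈S x₂∈S y₁∈S y₂∈S x₁<y₁ x₁<y₂ x₂<y₁ x₂<y₂
    with T-lattice x₁ x₂ y₁ y₂ (S⊆T x₁∈S) (S⊆T x₂∈S) (S⊆T y₁∈S) (S⊆T y₂∈S)
                   x₁<y₁ x₁<y₂ x₂<y₁ x₂<y₂
  ... | z , _ , x₁≼z , x₂≼z , z≼y₁ , z≼y₂ =
    z , S-convex x₁∈S y₁∈S x₁≼z z≼y₁ , x₁≼z , x₂≼z , z≼y₁ , z≼y₂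

lemma4 : (n : ℕ) (_≼_ : Rel (Fin n) 0ℓ) (_≼?_ : Decidable _≼_) →
         IsPartialOrder _≡_ _≼_ →
         Order.IsPartialLatticeOn _≼_ _≼?_ ⊤ →
         (k : ℕ) → 1 ≤ k →
         (blocks : List (Subset n)) → Order.BlockDecomp _≼_ _≼?_ k ⊤ blocks →
         All (Order.IsPartialLatticeOn _≼_ _≼?_) blocks
lemma4 n _≼_ _≼?_ po L-lattice k _ blocks decomp =
  All.map (convex⇒partialLattice _≼_ _≼?_ ⊆⊤ L-lattice) blocks-are-convex
  where
    ⊤-upClosed : UpClosed _≼_ _≼?_ ⊤
    ⊤-upClosed _ _ = ∈⊤

    blocks-are-convex : All (Convex _≼_ _≼?_) blocks
    blocks-are-convex = blocks-convex _≼_ _≼?_ (IsPartialOrder.trans po) ⊤-upClosed decomp
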